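{- Let $P$ be a finite poset and $U_o\sqcup U_c=P$ a partition. For order ideals $J_1,J_2\subset P$ one has $K_{U_o,U_c}(J_1)\cap K_{U_o,U_c}(J_2)\subset K_{U_o,U_c}(J_1\cup J_2)\subset K_{U_o,U_c}(J_1)\cup K_{U_o,U_c}(J_2)$.
   Context: An order ideal of $P$ is a subset $J$ such that $p\in J$ and $q<p$ imply $q\in J$. For an order ideal $J$, $K_{U_o,U_c}(J)$ is the set consisting of all elements of $J\cap U_o$ together with those elements of $J\cap U_c$ that are maximal in $J$. -}

module Defs where

open import Level using (0ℓ)
open import Data.Nat using (ℕ)
open import Data.Fin using (Fin)
open import Data.Product using (_×_; ∃)
open import Data.Sum using (_⊎_)
open import Relation.Nullary using (¬_)
open import Relation.Unary using (Pred; _∈_; _∩_; _∪_)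
open import Relation.Binary.PropositionalEquality using (_≡_)
open import Relation.Binary using (Rel; IsPartialOrder)

record FinPoset : Set₁ where
  field
    n          : ℕ
    _≤_        : Rel (Fin n) 0ℓ
    isPartialOrder : IsPartialOrder _≡_ _≤_

module _ (P : FinPoset) where
  open FinPoset P

  Subset : Set₁
  Subset = Pred (Fin n) 0ℓ

  _<_ : Fin n → Fin n → Set
  p < q = (p ≤ q) × ¬ (p ≡ q)

  IsPartition : Subset → Subset → Set
  IsPartition Uo Uc = (∀ p → p ∈ Uo ⊎ p ∈ Uc) × (∀ p → ¬ (p ∈ Uo × p ∈ Uc))

  IsOrderIdeal : Subset → Set
  IsOrderIdeal J = ∀ {p q} → p ∈ J → q < p → q ∈ J

  IsMaximalIn : Subset → Fin n → Set
  IsMaximalIn J p = p ∈ J × (∀ {q} → q ∈ J → ¬ (p < q))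

  K : Subset → Subset → Subset → Subset
  K Uo Uc J p = (p ∈ J × p ∈ Uo) ⊎ ((p ∈ J × p ∈ Uc) × IsMaximalIn J p)

module Submission where

open import Defs
open import Data.Product using (_×_; _,_)
open import Data.Sum using (inj₁; inj₂; [_,_])
open import Relation.Unary using (_∈_; _⊆_; _∩_; _∪_)

module _ (P : FinPoset) where

  isMaximalIn-∪ : ∀ {J₁ J₂ p} → IsMaximalIn P J₁ p → IsMaximalIn P J₂ p →
                  IsMaximalIn P (J₁ ∪ J₂) p
  isMaximalIn-∪ (p∈J₁ , max₁) (_ , max₂) = inj₁ p∈J₁ , [ max₁ , max₂ ]

  isMaximalIn-⊆ : ∀ {J J′ p} → J ⊆ J′ → p ∈ J → IsMaximalIn P J′ p → IsMaximalIn P J p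
  isMaximalIn-⊆ J⊆J′ p∈J (_ , max) = p∈J , λ q∈J → max (J⊆J′ q∈J)

  module _ (Uo Uc : Subset P) (J₁ J₂ : Subset P) where

    K-∩-⊆-K-∪ : (K P Uo Uc J₁ ∩ K P Uo Uc J₂) ⊆ K P Uo Uc (J₁ ∪ J₂)
    K-∩-⊆-K-∪ (inj₁ (p∈J₁ , p∈Uo) , _) = inj₁ (inj₁ p∈J₁ , p∈Uo)
    K-∩-⊆-K-∪ (inj₂ _ , inj₁ (p∈J₂ , p∈Uo)) = inj₁ (inj₂ p∈J₂ , p∈Uo)
    K-∩-⊆-K-∪ (inj₂ ((p∈J₁ , p∈Uc) , max₁) , inj₂ (_ , max₂)) =
      inj₂ ((inj₁ p∈J₁ , p∈Uc) , isMaximalIn-∪ max₁ max₂)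

    K-∪-⊆-K-∪-K : K P Uo Uc (J₁ ∪ J₂) ⊆ (K P Uo Uc J₁ ∪ K P Uo Uc J₂)
    K-∪-⊆-K-∪-K (inj₁ (inj₁ p∈J₁ , p∈Uo)) = inj₁ (inj₁ (p∈J₁ , p∈Uo))
    K-∪-⊆-K-∪-K (inj₁ (inj₂ p∈J₂ , p∈Uo)) = inj₂ (inj₁ (p∈J₂ , p∈Uo))
    K-∪-⊆-K-∪-K (inj₂ ((inj₁ p∈J₁ , p∈Uc) , max)) =
      inj₁ (inj₂ ((p∈J₁ , p∈Uc) , isMaximalIn-⊆ inj₁ p∈J₁ max))
    K-∪-⊆-K-∪-K (inj₂ ((inj₂ p∈J₂ , p∈Uc) , max)) =
      inj₂ (inj₂ ((p∈J₂ , p∈Uc) , isMaximalIn-⊆ inj₂ p∈J₂ max))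

proposition4p4 : (P : FinPoset) (Uo Uc : Subset P) → IsPartition P Uo Uc →
    (J₁ J₂ : Subset P) → IsOrderIdeal P J₁ → IsOrderIdeal P J₂ →
    ((K P Uo Uc J₁ ∩ K P Uo Uc J₂) ⊆ K P Uo Uc (J₁ ∪ J₂))
      × (K P Uo Uc (J₁ ∪ J₂) ⊆ (K P Uo Uc J₁ ∪ K P Uo Uc J₂))
proposition4p4 P Uo Uc _ J₁ J₂ _ _ =
  K-∩-⊆-K-∪ P Uo Uc J₁ J₂ , K-∪-⊆-K-∪-K P Uo Uc J₁ J₂
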